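{- Let $a,b,x,y$ be natural numbers with $m=ab=x+y-1$. Then there are natural numbers $v,w$ such that $v+w-1=a$ and $xy\equiv vw \pmod a$. Consequently, if $n=\langle x,y,z\rangle$ for some natural number $z$, then there exists a natural number $z'$ with $n=\langle v,w,z'\rangle$.
   Context: Natural numbers start at $1$. Let $\omega=e^{i\pi/3}$ and $\Lambda=\{m+n\omega : m,n\in\mathbb{Z}\}\subset\mathbb{C}$ the hexagonal lattice. For natural numbers $a,b,c$, the ternary product $\langle a,b,c\rangle$ is the number of points of $\Lambda$ in the closed (possibly degenerate) equiangular lattice hexagon with vertices $0$, $(a-1)$, $(a-1)+(b-1)\omega$, $(a-1)+(b-1)\omega+(c-1)\omega^2$, $(b-1)\omega+(c-1)\omega^2$, $(c-1)\omega^2$, i.e. the hexagon whose consecutive sides are parallel to $1,\omega,\omega^2,-1,-\omega,-\omega^2$ and contain $a,b,c,a,b,c$ lattice points. (Equivalently, $\langle a,b,c\rangle=ab+bc+ca-a-b-c+1$.) -}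

module Defs where

open import Data.Nat using (ℕ; _+_; _*_; _∸_)
open import Data.Integer as ℤ using (ℤ; +_)
open import Data.Integer.Divisibility using (_∣_)

-- Ternary product ⟨a,b,c⟩ = ab + bc + ca - a - b - c + 1 (intended for a,b,c ≥ 1,
-- where the truncated subtraction below is exact).
⟨_,_,_⟩ : ℕ → ℕ → ℕ → ℕ
⟨ a , b , c ⟩ = (a * b + b * c + c * a + 1) ∸ (a + b + c)

_≡ₘ_[mod_] : ℕ → ℕ → ℕ → Set
x ≡ₘ y [mod m ] = (+ m) ∣ ((+ x) ℤ.- (+ y))
infix 4 _≡ₘ_[mod_]

module Submission where

-- Write a = 1 + a' and x − 1 = s + a·q with 0 ≤ s < a
-- (division with remainder), and put v = s + 1, w = t + 1 where t = a' − s,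
-- so that v + w − 1 = a.  Since x + y − 1 = a·b, the other side is forced
-- to be y = w + a·r with b = 1 + q + r: x and y are v and w shifted by
-- multiples of a.  Two identities then finish the proof:
--   * x·y = v·w + a·K for an explicit K, so x·y ≡ v·w (mod a);
--   * the ternary product satisfies ⟨v, w, 1 + k⟩ = v·w + k·(v + w − 1),
--     hence ⟨x, y, 1 + k⟩ = x·y + k·a·b = v·w + (K + k·b)·a
--                        = ⟨v, w, 1 + K + k·b⟩.

open import Defs
open import Data.Nat using (ℕ; suc; s≤s; s≤s⁻¹; z≤n; _+_; _*_; _∸_; _≤_; _<_)
open import Data.Nat.Properties
  using (m+n∸n≡m; +-suc; +-cancelˡ-≡; *-cancelˡ-<; *-comm; m≤n+m; ≤-<-trans; m<m+n;
         m+[n∸m]≡n; +-identityʳ)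
open import Data.Nat.DivMod using (_%_; _/_; m%n<n; m≡m%n+[m/n]*n)
open import Data.Nat.Tactic.RingSolver using (solve-∀)
import Data.Nat.Divisibility as ℕ∣
import Data.Integer as ℤ
import Data.Integer.Properties as ℤ
open import Data.Product using (_×_; _,_; ∃-syntax)
open import Relation.Binary.PropositionalEquality
  using (_≡_; refl; sym; trans; cong; cong₂; subst; module ≡-Reasoning)

open ≡-Reasoning

-- Closed form of the ternary product: ⟨v, w, 1 + k⟩ = v·w + k·(v + w − 1),
-- i.e. the hexagon is a v × w parallelogram plus k rows of length v + w − 1.
ternary-closed-form : ∀ A B k →
  ⟨ suc A , suc B , suc k ⟩ ≡ suc A * suc B + k * suc (A + B)
ternary-closed-form A B k = begin
  ⟨ suc A , suc B , suc k ⟩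
    ≡⟨ cong (_∸ (suc A + suc B + suc k)) (expand A B k) ⟩
  (suc A * suc B + k * suc (A + B)) + (suc A + suc B + suc k) ∸ (suc A + suc B + suc k)
    ≡⟨ m+n∸n≡m _ (suc A + suc B + suc k) ⟩
  suc A * suc B + k * suc (A + B) ∎
  where
  expand : ∀ A B k →
    suc A * suc B + suc B * suc k + suc k * suc A + 1
      ≡ (suc A * suc B + k * suc (A + B)) + (suc A + suc B + suc k)
  expand = solve-∀

+-multiple-≡ₘ : ∀ m u K → u + m * K ≡ₘ u [mod m ]
+-multiple-≡ₘ m u K = subst (m ℕ∣.∣_) (sym ∣difference∣) (ℕ∣.m∣m*n K)
  where
  ∣difference∣ : ℤ.∣ ℤ.+ (u + m * K) ℤ.- ℤ.+ u ∣ ≡ m * K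
  ∣difference∣ = cong ℤ.∣_∣ (begin
    ℤ.+ (u + m * K) ℤ.- ℤ.+ u  ≡⟨ ℤ.m-n≡m⊖n (u + m * K) u ⟩
    (u + m * K) ℤ.⊖ u          ≡⟨ cong ((u + m * K) ℤ.⊖_) (sym (+-identityʳ u)) ⟩
    (u + m * K) ℤ.⊖ (u + 0)    ≡⟨ ℤ.+-cancelˡ-⊖ u (m * K) 0 ⟩
    ℤ.+ (m * K)                ∎)

residue-split : ∀ a' X → ∃[ s ] ∃[ t ] ∃[ q ] (a' ≡ s + t × X ≡ s + suc a' * q)
residue-split a' X = s , a' ∸ s , q , sym (m+[n∸m]≡n s≤a') , X≡s+aq
  where
  s = X % suc a'
  q = X / suc a'
  s≤a' : s ≤ a'
  s≤a' = s≤s⁻¹ (m%n<n X (suc a'))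
  X≡s+aq : X ≡ s + suc a' * q
  X≡s+aq = trans (m≡m%n+[m/n]*n X (suc a')) (cong (s +_) (*-comm q (suc a')))

complement-split : ∀ s t q b y → suc (s + t) * b ≡ s + suc (s + t) * q + y → 1 ≤ y →
  ∃[ r ] (b ≡ suc (q + r) × y ≡ suc (t + suc (s + t) * r))
complement-split s t q b y ab≡ y≥1 = r , sym b≡ , y≡
  where
  a = suc (s + t)
  aq<ab : a * q < a * b
  aq<ab = subst (a * q <_) (sym ab≡)
            (≤-<-trans (m≤n+m (a * q) s) (m<m+n (s + a * q) y≥1))
  r = b ∸ suc q
  b≡ : suc (q + r) ≡ b
  b≡ = m+[n∸m]≡n (*-cancelˡ-< a q b aq<ab)
  expand : ∀ s t q r →
    suc (s + t) * suc (q + r) ≡ s + suc (s + t) * q + suc (t + suc (s + t) * r)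
  expand = solve-∀
  y≡ : y ≡ suc (t + a * r)
  y≡ = +-cancelˡ-≡ (s + a * q) y _ (begin
    s + a * q + y          ≡⟨ sym ab≡ ⟩
    a * b                  ≡⟨ cong (a *_) (sym b≡) ⟩
    a * suc (q + r)        ≡⟨ expand s t q r ⟩
    s + a * q + suc (t + a * r) ∎)

shifted-product : ∀ s t q r →
  suc (s + suc (s + t) * q) * suc (t + suc (s + t) * r)
    ≡ suc s * suc t + suc (s + t) * (suc s * r + suc t * q + suc (s + t) * q * r)
shifted-product = solve-∀

shifted-congruence : ∀ s t q r →
  suc (s + suc (s + t) * q) * suc (t + suc (s + t) * r) ≡ₘ suc s * suc t [mod suc (s + t) ]
shifted-congruence s t q r =
  subst (λ p → p ≡ₘ suc s * suc t [mod suc (s + t) ]) (sym (shifted-product s t q r))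
        (+-multiple-≡ₘ (suc (s + t)) (suc s * suc t) (suc s * r + suc t * q + suc (s + t) * q * r))

shifted-perimeter : ∀ s t q r →
  suc ((s + suc (s + t) * q) + (t + suc (s + t) * r)) ≡ suc (s + t) * suc (q + r)
shifted-perimeter = solve-∀

shifted-ternary : ∀ s t q r k →
  let a = suc (s + t); b = suc (q + r)
      K = suc s * r + suc t * q + a * q * r in
  ⟨ suc (s + a * q) , suc (t + a * r) , suc k ⟩ ≡ ⟨ suc s , suc t , suc (K + k * b) ⟩
shifted-ternary s t q r k = begin
  ⟨ suc (s + a * q) , suc (t + a * r) , suc k ⟩
    ≡⟨ ternary-closed-form (s + a * q) (t + a * r) k ⟩
  suc (s + a * q) * suc (t + a * r) + k * suc ((s + a * q) + (t + a * r))
    ≡⟨ cong₂ (λ p c → p + k * c) (shifted-product s t q r) (shifted-perimeter s t q r) ⟩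
  (suc s * suc t + a * K) + k * (a * b)
    ≡⟨ regroup (suc s * suc t) a K k b ⟩
  suc s * suc t + (K + k * b) * a
    ≡⟨ sym (ternary-closed-form s t (K + k * b)) ⟩
  ⟨ suc s , suc t , suc (K + k * b) ⟩ ∎
  where
  a = suc (s + t)
  b = suc (q + r)
  K = suc s * r + suc t * q + a * q * r
  regroup : ∀ p a K k b → p + a * K + k * (a * b) ≡ p + (K + k * b) * a
  regroup = solve-∀

-- With a = 1 + a' and x = 1 + X, the hypothesis a·b = x + y − 1 is (definitionally)
-- a·b = X + y, which is the form complement-split expects; v = 1 + s, w = 1 + t.
mainTheorem3 : (a b x y : ℕ) → 1 ≤ a → 1 ≤ b → 1 ≤ x → 1 ≤ y →
    a * b ≡ x + y ∸ 1 →
    ∃[ v ] ∃[ w ] (1 ≤ v × 1 ≤ w × (v + w ∸ 1 ≡ a) × ((x * y) ≡ₘ (v * w) [mod a ]) ×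
    ((n z : ℕ) → 1 ≤ z → n ≡ ⟨ x , y , z ⟩ →
    ∃[ z′ ] (1 ≤ z′ × n ≡ ⟨ v , w , z′ ⟩)))
mainTheorem3 (suc a') b (suc X) y _ _ _ y≥1 ab≡
  with residue-split a' X
... | s , t , q , refl , refl
  with complement-split s t q b y ab≡ y≥1
... | r , refl , refl =
  suc s , suc t , s≤s z≤n , s≤s z≤n , +-suc s t ,
  shifted-congruence s t q r ,
  transfer
  where
  K = suc s * r + suc t * q + suc (s + t) * q * r
  transfer : (n z : ℕ) → 1 ≤ z → n ≡ ⟨ suc (s + suc (s + t) * q) , suc (t + suc (s + t) * r) , z ⟩ →
    ∃[ z′ ] (1 ≤ z′ × n ≡ ⟨ suc s , suc t , z′ ⟩)
  transfer n (suc k) _ refl = suc (K + k * suc (q + r)) , s≤s z≤n , shifted-ternary s t q r k
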